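{- Let $0<\delta\le1/8$ with $1/\delta$ an integer, let $\ell$ be an integer with $3\le\ell\le5$, and let $\xi=\lceil\ell\log_{1+\delta}\frac1\delta\rceil$. Let $A'$ be an instance (without release dates) in which all job sizes $p_j$, weights $w_j$ and machine speeds are integer powers of $1+\delta$. For $c\in\mathbb Z$ let $\Omega_c=\{c\xi+1,\dots,(c+1)\xi\}$, and for an integer $0\le\zeta\le\frac1{\delta^{\ell+1}}-1$ let $A_\zeta$ be the instance obtained from $A'$ by replacing the weight of each job $j$ by $w^\zeta_j=w_j(1+\delta)^\xi$ if $\log_{1+\delta}\frac{w_j}{p_j}\in\Omega_{v/\delta^{\ell+1}+\zeta}$ for some integer $v$, and $w^\zeta_j=w_j$ otherwise. Then: (i) for every solution $SOL$ and every such $\zeta$, $SOL(A')\le SOL(A_\zeta)$, and there exists $0\le\bar\zeta\le\frac1{\delta^{\ell+1}}-1$ with $SOL(A_{\bar\zeta})\le(1+2\delta)SOL(A')$; (ii) there exists $0\le\zeta'\le\frac1{\delta^{\ell+1}}-1$ such that $\mathcal O'(A')\le\mathcal O^{\zeta'}(A_{\zeta'})\le(1+2\delta)\mathcal O'(A')$, and if a solution $SOL_1$ satisfies $SOL_1(A_{\zeta'})\le(1+k'\delta)\mathcal O^{\zeta'}(A_{\zeta'})$ for some $k'>0$, then $SOL_1(A')\le(1+(2k'+2)\delta)\mathcal O'(A')$. Here $\mathcal O'$ and $\mathcal O^{\zeta}$ denote optimal solutions for $A'$ and $A_\zeta$ respectively.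
   Context: Scheduling without release dates on uniformly related machines, minimizing total weighted completion time. A solution is a partition of the jobs among the machines (the same object is a solution for all instances with the same jobs and machines). For an instance $X$, $SOL(X)$ is the total weighted completion time obtained when each machine processes its jobs from time $0$ without idle time in non-increasing order of density (weight/size) with respect to $X$.
   Formalization: The parameter $k'$ in (ii) takes only positive rational values, and jobs of equal density on a machine are processed in order of job index. -}

module Defs where

open import Data.Nat as ℕ using (ℕ; zero; suc; NonZero)
open import Data.Integer as ℤ using (ℤ; +_; -[1+_])
open import Data.Rational as ℚ using (ℚ; _/_; 1ℚ; 0ℚ)
open import Data.Fin as Fin using (Fin; toℕ)
open import Data.Bool using (Bool; true; false; if_then_else_; _∧_; _∨_)
open import Data.Product using (Σ; ∃; _×_)
open import Relation.Nullary using (¬_)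
open import Relation.Nullary.Decidable using (⌊_⌋)
open import Relation.Binary.PropositionalEquality using (_≡_)

-- δ = 1/D, with D a positive natural number.
-- The base 1 + δ = (D+1)/D and its inverse D/(D+1).
base : (D : ℕ) → .{{NonZero D}} → ℚ
base D = + suc D / D

baseInv : ℕ → ℚ
baseInv D = + D / suc D

δ : (D : ℕ) → .{{NonZero D}} → ℚ
δ D = + 1 / D

_^ℕ_ : ℚ → ℕ → ℚ
q ^ℕ zero = 1ℚ
q ^ℕ suc n = q ℚ.* (q ^ℕ n)

pw : (D : ℕ) → .{{NonZero D}} → ℤ → ℚ
pw D (+ n) = base D ^ℕ n
pw D -[1+ n ] = baseInv D ^ℕ suc n

sumFin : (n : ℕ) → (Fin n → ℚ) → ℚ
sumFin zero f = 0ℚ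
sumFin (suc n) f = f Fin.zero ℚ.+ sumFin n (λ i → f (Fin.suc i))

-- An instance (without release dates) with n jobs and m machines, in
-- which every job size, job weight and machine speed is an integer power
-- of 1 + δ; the instance is recorded by these integer exponents:
-- p_j = (1+δ)^(size j), w_j = (1+δ)^(weight j), s_i = (1+δ)^(speed i).
record Instance (n m : ℕ) : Set where
  field
    size   : Fin n → ℤ
    weight : Fin n → ℤ
    speed  : Fin m → ℤ
open Instance public

reweight : ∀ {n m} → Instance n m → (Fin n → ℤ) → Instance n m
reweight X w = record { size = size X ; weight = w ; speed = speed X }

Solution : ℕ → ℕ → Set
Solution n m = Fin n → Fin m

logDensity : ∀ {n m} → Instance n m → Fin n → ℤ
logDensity X j = weight X j ℤ.- size X j

-- k is processed no later than j on a common machine in the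
-- non-increasing density order (ties broken by job index; the objective
-- value does not depend on how ties are broken).
precedesOrEq : ∀ {n m} → Instance n m → Fin n → Fin n → Bool
precedesOrEq X k j =
  ⌊ logDensity X j ℤ.<? logDensity X k ⌋
  ∨ (⌊ logDensity X j ℤ.≟ logDensity X k ⌋ ∧ ⌊ toℕ k ℕ.≤? toℕ j ⌋)

-- completion time of job j: machine σ j processes its jobs from time 0
-- without idle time in non-increasing order of density;
-- job k takes p_k / s_{σ j} = (1+δ)^(size k - speed (σ j)) time units.
completion : (D : ℕ) → .{{NonZero D}} → ∀ {n m} →
             Instance n m → Solution n m → Fin n → ℚ
completion D {n} X σ j =
  sumFin n (λ k →
    if ⌊ σ k Fin.≟ σ j ⌋ ∧ precedesOrEq X k j
    then pw D (size X k ℤ.- speed X (σ j))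
    else 0ℚ)

SOL : (D : ℕ) → .{{NonZero D}} → ∀ {n m} →
      Solution n m → Instance n m → ℚ
SOL D {n} σ X = sumFin n (λ j → pw D (weight X j) ℚ.* completion D X σ j)

IsOptimal : (D : ℕ) → .{{NonZero D}} → ∀ {n m} →
            Instance n m → Solution n m → Set
IsOptimal D X σ = ∀ τ → SOL D σ X ℚ.≤ SOL D τ X

-- ξ = ⌈ ℓ log_{1+δ} (1/δ) ⌉ : the least integer k with (1/δ)^ℓ ≤ (1+δ)^k
IsXi : (D : ℕ) → .{{NonZero D}} → ℕ → ℕ → Set
IsXi D ℓ ξ =
  (+ (D ℕ.^ ℓ) / 1 ℚ.≤ pw D (+ ξ)) ×
  (∀ (k : ℤ) → + (D ℕ.^ ℓ) / 1 ℚ.≤ pw D k → + ξ ℤ.≤ k)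

_∈Ω[_,_] : ℤ → ℕ → ℤ → Set
e ∈Ω[ ξ , c ] = (c ℤ.* + ξ ℤ.+ + 1 ℤ.≤ e) × (e ℤ.≤ (c ℤ.+ + 1) ℤ.* + ξ)

-- job j of X is boosted for ζ: log_{1+δ}(w_j/p_j) ∈ Ω_{v/δ^(ℓ+1)+ζ}
-- for some integer v  (1/δ^(ℓ+1) = D^(ℓ+1))
Boosted : (D ℓ ξ ζ : ℕ) → ∀ {n m} → Instance n m → Fin n → Set
Boosted D ℓ ξ ζ X j =
  ∃ λ (v : ℤ) → logDensity X j ∈Ω[ ξ , v ℤ.* + (D ℕ.^ suc ℓ) ℤ.+ + ζ ]

IsWeightsζ : (D ℓ ξ ζ : ℕ) → ∀ {n m} → Instance n m → (Fin n → ℤ) → Set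
IsWeightsζ D ℓ ξ ζ X w' =
  ∀ j → (Boosted D ℓ ξ ζ X j → w' j ≡ weight X j ℤ.+ + ξ)
      × (¬ Boosted D ℓ ξ ζ X j → w' j ≡ weight X j)

module Submission where

-- Fix a solution σ (an assignment of jobs to machines).
--  * Smith's rule (module Sequencing): ordering every machine by
--    non-increasing density w/p minimises Σ w_j C_j over all priority orders.
--    Summing the cost twice pairs (a, j) with (j, a), and in each pair the
--    density order pays the cheaper of w_j p_a and w_a p_j.
--  * Hence raising weights raises SOL (SOL-monoʷ); this is the lower bound
--    SOL(A') ≤ SOL(A_ζ) of (i).
--  * The blocks Ω_c partition ℤ, and their N = D^(ℓ+1) residue classes put
--    every job into exactly one class (module Blocks): each job is boosted
--    in exactly one of A_0, …, A_(N-1).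
--  * Evaluating A_ζ with the order of A' (Smith's rule again) and summing
--    over ζ gives Σ_ζ SOL(A_ζ) ≤ (N + (1+δ)^ξ - 1) SOL(A') ≤ N (1+2δ) SOL(A'),
--    because (1+δ)^ξ ≤ 2 D^ℓ = 2 N δ by the minimality of ξ; the cheapest ζ̄
--    is below the average.

open import Algebra.Bundles using (CommutativeRing)
import Algebra.Properties.Semiring.Sum as SemiringSum
open import Data.Bool using (Bool; true; false; not; if_then_else_; _∧_; _∨_)
open import Data.Empty using (⊥; ⊥-elim)
open import Data.Fin as Fin using (Fin; toℕ)
import Data.Fin.Properties as FinP
open import Data.Integer as ℤ using (ℤ; +_; -[1+_])
open import Data.Integer.DivMod using (_/ℕ_; _%ℕ_; a≡a%ℕn+[a/ℕn]*n; n%ℕd<d)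
import Data.Integer.Properties as ℤP
open import Data.Integer.Tactic.RingSolver using (solve-∀)
open import Data.List using (allFin)
import Data.List.Extrema
open import Data.List.Membership.Propositional.Properties using (∈-allFin)
import Data.List.Relation.Unary.All as All
open import Data.Nat as ℕ using (ℕ; zero; suc)
import Data.Nat.Properties as ℕP
import Data.Nat.Tactic.RingSolver as ℕSolver
open import Data.Product using (∃; _×_; _,_; proj₁; proj₂)
open import Data.Rational as ℚ using (ℚ; 1ℚ; 0ℚ; _+_; _*_; _-_; _/_; _≤_; _<_)
open import Data.Rational.Properties as ℚP
  using (toℚᵘ-injective; toℚᵘ-fromℚᵘ; toℚᵘ-homo-+; toℚᵘ-homo-*; toℚᵘ-cancel-≤; fromℚᵘ-cong)
import Data.Rational.Solver
open import Data.Rational.Unnormalised as ℚᵘ using (mkℚᵘ; *≡*; *≤*)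
import Data.Rational.Unnormalised.Properties as ℚᵘP
open import Data.Sum using (_⊎_; inj₁; inj₂; [_,_]′)
open import Function using (_∘_; case_of_)
open import Relation.Binary.Bundles using (DecTotalOrder)
open import Relation.Binary.Definitions using (tri<; tri≈; tri>)
open import Relation.Binary.PropositionalEquality
open import Relation.Nullary using (Dec; yes; no; ¬_; contradiction)
open import Relation.Nullary.Decidable using (⌊_⌋; isYes≗does; dec-true; dec-false)

open import Algebra.Properties.CommutativeSemigroup
  (CommutativeRing.*-commutativeSemigroup ℚP.+-*-commutativeRing)
  using (interchange; xy∙z≈xz∙y; xy∙z≈y∙xz)

open import Defs

-- Rational arithmetic: fractions are computed through ℚᵘ

fromℚᵘ-homo-+ : ∀ p q → ℚ.fromℚᵘ (p ℚᵘ.+ q) ≡ ℚ.fromℚᵘ p + ℚ.fromℚᵘ q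
fromℚᵘ-homo-+ p q = toℚᵘ-injective (ℚᵘP.≃-trans (toℚᵘ-fromℚᵘ (p ℚᵘ.+ q))
  (ℚᵘP.≃-sym (ℚᵘP.≃-trans (toℚᵘ-homo-+ (ℚ.fromℚᵘ p) (ℚ.fromℚᵘ q))
                          (ℚᵘP.+-cong (toℚᵘ-fromℚᵘ p) (toℚᵘ-fromℚᵘ q)))))

fromℚᵘ-homo-* : ∀ p q → ℚ.fromℚᵘ (p ℚᵘ.* q) ≡ ℚ.fromℚᵘ p * ℚ.fromℚᵘ q
fromℚᵘ-homo-* p q = toℚᵘ-injective (ℚᵘP.≃-trans (toℚᵘ-fromℚᵘ (p ℚᵘ.* q))
  (ℚᵘP.≃-sym (ℚᵘP.≃-trans (toℚᵘ-homo-* (ℚ.fromℚᵘ p) (ℚ.fromℚᵘ q))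
                          (ℚᵘP.*-cong (toℚᵘ-fromℚᵘ p) (toℚᵘ-fromℚᵘ q)))))

fraction-≡ : ∀ p q → ℚᵘ.↥ p ℤ.* ℚᵘ.↧ q ≡ ℚᵘ.↥ q ℤ.* ℚᵘ.↧ p → ℚ.fromℚᵘ p ≡ ℚ.fromℚᵘ q
fraction-≡ p q h = fromℚᵘ-cong {p} {q} (*≡* h)

fraction-≤ : ∀ p q → ℚᵘ.↥ p ℤ.* ℚᵘ.↧ q ℤ.≤ ℚᵘ.↥ q ℤ.* ℚᵘ.↧ p → ℚ.fromℚᵘ p ≤ ℚ.fromℚᵘ q
fraction-≤ p q h = toℚᵘ-cancel-≤ (ℚᵘP.≤-respˡ-≃ (ℚᵘP.≃-sym (toℚᵘ-fromℚᵘ p))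
                                   (ℚᵘP.≤-respʳ-≃ (ℚᵘP.≃-sym (toℚᵘ-fromℚᵘ q)) (*≤* h)))

*-monoˡ-≤ : ∀ {r p q} → 0ℚ ≤ r → p ≤ q → r * p ≤ r * q
*-monoˡ-≤ {r} 0≤r = ℚP.*-monoˡ-≤-nonNeg r {{ℚ.nonNegative 0≤r}}

*-monoʳ-≤ : ∀ {r p q} → 0ℚ ≤ r → p ≤ q → p * r ≤ q * r
*-monoʳ-≤ {r} 0≤r = ℚP.*-monoʳ-≤-nonNeg r {{ℚ.nonNegative 0≤r}}

*-nonNeg : ∀ {p q} → 0ℚ ≤ p → 0ℚ ≤ q → 0ℚ ≤ p * q
*-nonNeg {p} {q} 0≤p 0≤q = subst (_≤ p * q) (ℚP.*-zeroʳ p) (*-monoˡ-≤ 0≤p 0≤q)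

*-pos : ∀ {p q} → 0ℚ < p → 0ℚ < q → 0ℚ < p * q
*-pos {p} {q} 0<p 0<q =
  ℚP.positive⁻¹ (p * q) {{ℚP.pos*pos⇒pos p {{ℚ.positive 0<p}} q {{ℚ.positive 0<q}}}}

x≤x+y : ∀ {x y} → 0ℚ ≤ y → x ≤ x + y
x≤x+y {x} 0≤y = subst (_≤ x + _) (ℚP.+-identityʳ x) (ℚP.+-monoʳ-≤ x 0≤y)

0≤1+x : ∀ {x} → 0ℚ ≤ x → 0ℚ ≤ 1ℚ + x
0≤1+x 0≤x = ℚP.≤-trans (ℚP.nonNegative⁻¹ 1ℚ) (x≤x+y 0≤x)

x-1≤x : ∀ x → x - 1ℚ ≤ x
x-1≤x x = subst (x - 1ℚ ≤_) (ℚP.+-identityʳ x) (ℚP.+-monoʳ-≤ x (ℚP.nonPositive⁻¹ (ℚ.- 1ℚ)))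

approximation-chain : ∀ {k ε} → 0ℚ ≤ k → 0ℚ ≤ ε → (+ 2 / 1) * ε ≤ 1ℚ →
  (1ℚ + k * ε) * (1ℚ + (+ 2 / 1) * ε) ≤ 1ℚ + ((+ 2 / 1) * k + + 2 / 1) * ε
approximation-chain {k} {ε} 0≤k 0≤ε 2ε≤1 = subst ((1ℚ + k * ε) * (1ℚ + (+ 2 / 1) * ε) ≤_) (sym (expand k ε))
  (x≤x+y (*-nonNeg (*-nonNeg 0≤k 0≤ε) 0≤1-2ε))
  where
  0≤1-2ε : 0ℚ ≤ 1ℚ - (+ 2 / 1) * ε
  0≤1-2ε = subst (_≤ 1ℚ - (+ 2 / 1) * ε) (ℚP.+-inverseʳ ((+ 2 / 1) * ε))
                 (ℚP.+-monoˡ-≤ (ℚ.- ((+ 2 / 1) * ε)) 2ε≤1)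
  open Data.Rational.Solver.+-*-Solver
  expand : ∀ k ε → 1ℚ + ((+ 2 / 1) * k + + 2 / 1) * ε
                 ≡ (1ℚ + k * ε) * (1ℚ + (+ 2 / 1) * ε) + (k * ε) * (1ℚ - (+ 2 / 1) * ε)
  expand = solve 2 (λ k ε → con 1ℚ :+ (con (+ 2 / 1) :* k :+ con (+ 2 / 1)) :* ε
                         := (con 1ℚ :+ k :* ε) :* (con 1ℚ :+ con (+ 2 / 1) :* ε)
                              :+ (k :* ε) :* (con 1ℚ :- con (+ 2 / 1) :* ε)) refl

^ℕ-+ : ∀ q m n → q ^ℕ (m ℕ.+ n) ≡ q ^ℕ m * q ^ℕ n
^ℕ-+ q zero    n = sym (ℚP.*-identityˡ _)
^ℕ-+ q (suc m) n = trans (cong (q *_) (^ℕ-+ q m n)) (sym (ℚP.*-assoc q _ _))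

^ℕ-pos : ∀ {q} → 0ℚ < q → ∀ n → 0ℚ < q ^ℕ n
^ℕ-pos 0<q zero    = ℚP.positive⁻¹ 1ℚ
^ℕ-pos 0<q (suc n) = *-pos 0<q (^ℕ-pos 0<q n)

1≤^ℕ : ∀ {q} → 1ℚ ≤ q → ∀ n → 1ℚ ≤ q ^ℕ n
1≤^ℕ 1≤q zero    = ℚP.≤-refl
1≤^ℕ {q} 1≤q (suc n) = ℚP.≤-trans 1≤q (subst (_≤ q * q ^ℕ n) (ℚP.*-identityʳ q)
  (*-monoˡ-≤ (ℚP.≤-trans (ℚP.nonNegative⁻¹ 1ℚ) 1≤q) (1≤^ℕ 1≤q n)))

fromℕ : ℕ → ℚ
fromℕ n = + n / 1

fromℕ-suc : ∀ n → fromℕ (suc n) ≡ 1ℚ + fromℕ n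
fromℕ-suc n = trans (fraction-≡ (mkℚᵘ (+ suc n) 0) (mkℚᵘ (+ 1) 0 ℚᵘ.+ mkℚᵘ (+ n) 0) (cross (+ n)))
                    (fromℚᵘ-homo-+ (mkℚᵘ (+ 1) 0) (mkℚᵘ (+ n) 0))
  where
  cross : ∀ x → (ℤ.1ℤ ℤ.+ x) ℤ.* ℤ.1ℤ ≡ (ℤ.1ℤ ℤ.* ℤ.1ℤ ℤ.+ x ℤ.* ℤ.1ℤ) ℤ.* ℤ.1ℤ
  cross = solve-∀

fromℕ-* : ∀ m n → fromℕ (m ℕ.* n) ≡ fromℕ m * fromℕ n
fromℕ-* m n = trans (fraction-≡ (mkℚᵘ (+ (m ℕ.* n)) 0) (mkℚᵘ (+ m) 0 ℚᵘ.* mkℚᵘ (+ n) 0)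
                                (cong (ℤ._* + 1) (ℤP.pos-* m n)))
                    (fromℚᵘ-homo-* (mkℚᵘ (+ m) 0) (mkℚᵘ (+ n) 0))

fromℕ-pos : ∀ n .{{_ : ℕ.NonZero n}} → 0ℚ < fromℕ n
fromℕ-pos n = ℚP.positive⁻¹ (fromℕ n) {{ℚP.normalize-pos n 1}}

fromℕ-mono : ∀ {m n} → m ℕ.≤ n → fromℕ m ≤ fromℕ n
fromℕ-mono {m} {n} m≤n = fraction-≤ (mkℚᵘ (+ m) 0) (mkℚᵘ (+ n) 0)
  (subst₂ ℤ._≤_ (sym (ℤP.*-identityʳ (+ m))) (sym (ℤP.*-identityʳ (+ n))) (ℤ.+≤+ m≤n))

fromℕ-nonNeg : ∀ n → 0ℚ ≤ fromℕ n
fromℕ-nonNeg n = fromℕ-mono {0} {n} ℕ.z≤n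

module Powers (d : ℕ) where
  D : ℕ
  D = suc d

  base≡1+δ : base D ≡ 1ℚ + δ D
  base≡1+δ = trans (fraction-≡ (mkℚᵘ (+ suc D) d) (mkℚᵘ (+ 1) 0 ℚᵘ.+ mkℚᵘ (+ 1) d) (cong +_ (cross d)))
                   (fromℚᵘ-homo-+ (mkℚᵘ (+ 1) 0) (mkℚᵘ (+ 1) d))
    where
    cross : ∀ k → (2 ℕ.+ k) ℕ.* (1 ℕ.* (1 ℕ.+ k)) ≡ (1 ℕ.* (1 ℕ.+ k) ℕ.+ 1 ℕ.* 1) ℕ.* (1 ℕ.+ k)
    cross = ℕSolver.solve-∀

  base*baseInv≡1 : base D * baseInv D ≡ 1ℚ
  base*baseInv≡1 = trans (sym (fromℚᵘ-homo-* (mkℚᵘ (+ suc D) d) (mkℚᵘ (+ D) D)))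
    (fraction-≡ (mkℚᵘ (+ suc D) d ℚᵘ.* mkℚᵘ (+ D) D) (mkℚᵘ (+ 1) 0) (cong +_ (cross d)))
    where
    cross : ∀ k → ((2 ℕ.+ k) ℕ.* (1 ℕ.+ k)) ℕ.* 1 ≡ 1 ℕ.* ((1 ℕ.+ k) ℕ.* (2 ℕ.+ k))
    cross = ℕSolver.solve-∀

  D*δ≡1 : fromℕ D * δ D ≡ 1ℚ
  D*δ≡1 = trans (sym (fromℚᵘ-homo-* (mkℚᵘ (+ D) 0) (mkℚᵘ (+ 1) d)))
    (fraction-≡ (mkℚᵘ (+ D) 0 ℚᵘ.* mkℚᵘ (+ 1) d) (mkℚᵘ (+ 1) 0) (cong +_ (cross d)))
    where
    cross : ∀ k → ((1 ℕ.+ k) ℕ.* 1) ℕ.* 1 ≡ 1 ℕ.* (1 ℕ.* (1 ℕ.+ k))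
    cross = ℕSolver.solve-∀

  δ≤1 : δ D ≤ 1ℚ
  δ≤1 = fraction-≤ (mkℚᵘ (+ 1) d) (mkℚᵘ (+ 1) 0) (ℤ.+≤+ (ℕ.s≤s ℕ.z≤n))

  δ-nonNeg : 0ℚ ≤ δ D
  δ-nonNeg = fraction-≤ (mkℚᵘ (+ 0) 0) (mkℚᵘ (+ 1) d) (ℤ.+≤+ ℕ.z≤n)

  pw-⊖ : ∀ m n → pw D (m ℤ.⊖ n) ≡ base D ^ℕ m * baseInv D ^ℕ n
  pw-⊖ zero    zero    = refl
  pw-⊖ (suc m) zero    = sym (ℚP.*-identityʳ _)
  pw-⊖ zero    (suc n) = sym (ℚP.*-identityˡ _)
  pw-⊖ (suc m) (suc n) = begin
    pw D (suc m ℤ.⊖ suc n)                            ≡⟨ cong (pw D) (ℤP.[1+m]⊖[1+n]≡m⊖n m n) ⟩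
    pw D (m ℤ.⊖ n)                                    ≡⟨ pw-⊖ m n ⟩
    b ^ℕ m * bi ^ℕ n                                  ≡⟨ ℚP.*-identityˡ _ ⟨
    1ℚ * (b ^ℕ m * bi ^ℕ n)                           ≡⟨ cong (_* (b ^ℕ m * bi ^ℕ n)) base*baseInv≡1 ⟨
    (b * bi) * (b ^ℕ m * bi ^ℕ n)                     ≡⟨ interchange b bi (b ^ℕ m) (bi ^ℕ n) ⟩
    (b * b ^ℕ m) * (bi * bi ^ℕ n)                     ∎
    where
    open ≡-Reasoning
    b bi : ℚ
    b = base D
    bi = baseInv D

  pw-+ : ∀ x y → pw D (x ℤ.+ y) ≡ pw D x * pw D y
  pw-+ (+ m)    (+ n)    = ^ℕ-+ (base D) m n
  pw-+ (+ m)    -[1+ n ] = pw-⊖ m (suc n)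
  pw-+ -[1+ m ] (+ n)    = trans (pw-⊖ n (suc m)) (ℚP.*-comm (base D ^ℕ n) _)
  pw-+ -[1+ m ] -[1+ n ] =
    trans (cong (λ k → baseInv D ^ℕ suc k) (sym (ℕP.+-suc m n))) (^ℕ-+ (baseInv D) (suc m) (suc n))

  pw-pos : ∀ e → 0ℚ < pw D e
  pw-pos (+ n)    = ^ℕ-pos (ℚP.positive⁻¹ (base D) {{ℚP.normalize-pos (suc D) D}}) n
  pw-pos -[1+ n ] = ^ℕ-pos (ℚP.positive⁻¹ (baseInv D) {{ℚP.normalize-pos D (suc D)}}) (suc n)

  pw-nonNeg : ∀ e → 0ℚ ≤ pw D e
  pw-nonNeg e = ℚP.<⇒≤ (pw-pos e)

  1≤base : 1ℚ ≤ base D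
  1≤base = subst (1ℚ ≤_) (sym base≡1+δ) (x≤x+y δ-nonNeg)

  pw-mono : ∀ {x y} → x ℤ.≤ y → pw D x ≤ pw D y
  pw-mono {x} {y} x≤y = begin
    pw D x                    ≡⟨ ℚP.*-identityʳ (pw D x) ⟨
    pw D x * 1ℚ               ≤⟨ *-monoˡ-≤ (pw-nonNeg x) 1≤pw[y-x] ⟩
    pw D x * pw D (y ℤ.- x)   ≡⟨ pw-+ x (y ℤ.- x) ⟨
    pw D (x ℤ.+ (y ℤ.- x))    ≡⟨ cong (pw D) (x+[y-x]≡y x y) ⟩
    pw D y                    ∎
    where
    open ℚP.≤-Reasoning
    x+[y-x]≡y : ∀ x y → x ℤ.+ (y ℤ.- x) ≡ y
    x+[y-x]≡y = solve-∀
    1≤pw[y-x] : 1ℚ ≤ pw D (y ℤ.- x)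
    1≤pw[y-x] = subst (λ e → 1ℚ ≤ pw D e) (ℤP.0≤i⇒+∣i∣≡i (ℤP.i≤j⇒0≤j-i x≤y))
                      (1≤^ℕ 1≤base ℤ.∣ y ℤ.- x ∣)

  -- the exchange inequality behind Smith's rule, for quantities that are powers of 1 + δ:
  -- if job a has at least the density of job j then w_j p_a ≤ w_a p_j
  pw-exchange : ∀ {wa sa wj sj} c → wj ℤ.- sj ℤ.≤ wa ℤ.- sa →
    pw D wj * pw D (sa ℤ.- c) ≤ pw D wa * pw D (sj ℤ.- c)
  pw-exchange {wa} {sa} {wj} {sj} c ρj≤ρa = begin
    pw D wj * pw D (sa ℤ.- c)                 ≡⟨ pw-+ wj (sa ℤ.- c) ⟨
    pw D (wj ℤ.+ (sa ℤ.- c))                  ≡⟨ cong (pw D) (regroup wj sj sa c) ⟩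
    pw D ((wj ℤ.- sj) ℤ.+ (sj ℤ.+ sa ℤ.- c))  ≤⟨ pw-mono (ℤP.+-monoˡ-≤ (sj ℤ.+ sa ℤ.- c) ρj≤ρa) ⟩
    pw D ((wa ℤ.- sa) ℤ.+ (sj ℤ.+ sa ℤ.- c))  ≡⟨ cong (pw D) (regroup' wa sa sj c) ⟨
    pw D (wa ℤ.+ (sj ℤ.- c))                  ≡⟨ pw-+ wa (sj ℤ.- c) ⟩
    pw D wa * pw D (sj ℤ.- c)                 ∎
    where
    open ℚP.≤-Reasoning
    regroup : ∀ w x y c → w ℤ.+ (y ℤ.- c) ≡ (w ℤ.- x) ℤ.+ (x ℤ.+ y ℤ.- c)
    regroup = solve-∀
    regroup' : ∀ w y x c → w ℤ.+ (x ℤ.- c) ≡ (w ℤ.- y) ℤ.+ (x ℤ.+ y ℤ.- c)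
    regroup' = solve-∀

  -- ξ = ⌈ℓ log_{1+δ} D⌉ is the least exponent with D^ℓ ≤ (1+δ)^ξ; hence (1+δ)^ξ ≤ 2 D^ℓ
  ξ-upper : ∀ {ℓ ξ'} → IsXi D ℓ (suc ξ') → pw D (+ suc ξ') ≤ (+ 2 / 1) * fromℕ (D ℕ.^ ℓ)
  ξ-upper {ℓ} {ξ'} (_ , least) = begin
    base D * pw D (+ ξ')    ≤⟨ *-monoˡ-≤ (ℚP.≤-trans (ℚP.nonNegative⁻¹ 1ℚ) 1≤base) (ℚP.<⇒≤ below) ⟩
    base D * L              ≡⟨ cong (_* L) base≡1+δ ⟩
    (1ℚ + δ D) * L          ≤⟨ *-monoʳ-≤ (fromℕ-nonNeg (D ℕ.^ ℓ)) (ℚP.+-monoʳ-≤ 1ℚ δ≤1) ⟩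
    (1ℚ + 1ℚ) * L           ∎
    where
    open ℚP.≤-Reasoning
    L : ℚ
    L = fromℕ (D ℕ.^ ℓ)
    below : pw D (+ ξ') < L
    below = ℚP.≰⇒> (λ L≤pwξ' → ℕP.<-irrefl refl (ℤP.drop‿+≤+ (least (+ ξ') L≤pwξ')))

  ξ≢0 : ∀ {ℓ} → 2 ℕ.≤ D ℕ.^ ℓ → ¬ IsXi D ℓ 0
  ξ≢0 2≤D^ℓ (D^ℓ≤1 , _) = ℚP.≤⇒≤ᵇ (ℚP.≤-trans (fromℕ-mono 2≤D^ℓ) D^ℓ≤1)

2δ≤1 : ∀ d → (+ 2 / 1) * δ (2 ℕ.+ d) ≤ 1ℚ
2δ≤1 d = subst (_≤ 1ℚ) (fromℚᵘ-homo-* (mkℚᵘ (+ 2) 0) (mkℚᵘ (+ 1) (suc d)))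
  (fraction-≤ (mkℚᵘ (+ 2) 0 ℚᵘ.* mkℚᵘ (+ 1) (suc d)) (mkℚᵘ (+ 1) 0) (ℤ.+≤+ (ℕ.s≤s (ℕ.s≤s ℕ.z≤n))))

module Sum = SemiringSum (CommutativeRing.semiring ℚP.+-*-commutativeRing)

sumFin≡sum : ∀ n (f : Fin n → ℚ) → sumFin n f ≡ Sum.sum f
sumFin≡sum zero    f = refl
sumFin≡sum (suc n) f = cong (λ s → f Fin.zero + s) (sumFin≡sum n (λ i → f (Fin.suc i)))

sumFin-cong : ∀ n {f g : Fin n → ℚ} → (∀ i → f i ≡ g i) → sumFin n f ≡ sumFin n g
sumFin-cong n {f} {g} f≗g =
  trans (sumFin≡sum n f) (trans (Sum.sum-cong-≗ f≗g) (sym (sumFin≡sum n g)))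

sumFin-+ : ∀ n (f g : Fin n → ℚ) → sumFin n (λ i → f i + g i) ≡ sumFin n f + sumFin n g
sumFin-+ n f g = trans (sumFin≡sum n _)
  (trans (Sum.∑-distrib-+ f g) (sym (cong₂ _+_ (sumFin≡sum n f) (sumFin≡sum n g))))

sumFin-*ˡ : ∀ n c (f : Fin n → ℚ) → c * sumFin n f ≡ sumFin n (λ i → c * f i)
sumFin-*ˡ n c f = trans (cong (c *_) (sumFin≡sum n f))
  (trans (Sum.*-distribˡ-sum c f) (sym (sumFin≡sum n (λ i → c * f i))))

sumFin-comm : ∀ n m (f : Fin n → Fin m → ℚ) →
  sumFin n (λ i → sumFin m (f i)) ≡ sumFin m (λ j → sumFin n (λ i → f i j))
sumFin-comm n m f = trans (nested n m f) (trans (Sum.∑-comm f) (sym (nested m n (λ j i → f i j))))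
  where
  nested : ∀ n m (f : Fin n → Fin m → ℚ) → sumFin n (λ i → sumFin m (f i)) ≡ Sum.sum (λ i → Sum.sum (f i))
  nested n m f = trans (sumFin≡sum n _) (Sum.sum-cong-≗ (λ i → sumFin≡sum m (f i)))

sumFin-const : ∀ n c → sumFin n (λ _ → c) ≡ fromℕ n * c
sumFin-const zero    c = sym (ℚP.*-zeroˡ c)
sumFin-const (suc n) c = begin
  c + sumFin n (λ _ → c)   ≡⟨ cong₂ _+_ (sym (ℚP.*-identityˡ c)) (sumFin-const n c) ⟩
  1ℚ * c + fromℕ n * c     ≡⟨ ℚP.*-distribʳ-+ c 1ℚ (fromℕ n) ⟨
  (1ℚ + fromℕ n) * c       ≡⟨ cong (_* c) (fromℕ-suc n) ⟨
  fromℕ (suc n) * c        ∎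
  where open ≡-Reasoning

sumFin-zero : ∀ n → sumFin n (λ _ → 0ℚ) ≡ 0ℚ
sumFin-zero n = trans (sumFin-const n 0ℚ) (ℚP.*-zeroʳ (fromℕ n))

sumFin-mono : ∀ n {f g : Fin n → ℚ} → (∀ i → f i ≤ g i) → sumFin n f ≤ sumFin n g
sumFin-mono zero    f≤g = ℚP.≤-refl
sumFin-mono (suc n) f≤g = ℚP.+-mono-≤ (f≤g Fin.zero) (sumFin-mono n (λ i → f≤g (Fin.suc i)))

sumFin-nonNeg : ∀ n {f : Fin n → ℚ} → (∀ i → 0ℚ ≤ f i) → 0ℚ ≤ sumFin n f
sumFin-nonNeg n 0≤f = subst (_≤ sumFin n _) (sumFin-zero n) (sumFin-mono n 0≤f)

-- ⌊ suc a ≟ suc z ⌋ does not reduce to ⌊ a ≟ z ⌋ by computation alone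
⌊suc≟suc⌋ : ∀ a z → ⌊ suc a ℕ.≟ suc z ⌋ ≡ ⌊ a ℕ.≟ z ⌋
⌊suc≟suc⌋ a z with a ℕ.≟ z
... | yes refl = trans (isYes≗does (suc a ℕ.≟ suc a)) (dec-true (suc a ℕ.≟ suc a) refl)
... | no a≢z  = trans (isYes≗does (suc a ℕ.≟ suc z)) (dec-false (suc a ℕ.≟ suc z) (a≢z ∘ ℕP.suc-injective))

sumFin-point : ∀ N z x → z ℕ.< N → sumFin N (λ i → if ⌊ toℕ i ℕ.≟ z ⌋ then x else 0ℚ) ≡ x
sumFin-point (suc N) zero    x _ = trans (cong (λ t → x + t) (sumFin-zero N)) (ℚP.+-identityʳ x)
sumFin-point (suc N) (suc z) x (ℕ.s≤s z<N) =
  trans (ℚP.+-identityˡ _) (trans (sumFin-cong N (λ i → cong (λ b → if b then x else 0ℚ) (⌊suc≟suc⌋ (toℕ i) z)))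
                                   (sumFin-point N z x z<N))

module Extrema = Data.List.Extrema (DecTotalOrder.totalOrder ℚP.≤-decTotalOrder)

argmin-Fin : ∀ {m} (g : Fin m → ℚ) → Fin m → ∃ λ i → ∀ j → g i ≤ g j
argmin-Fin {m} g i₀ = Extrema.argmin g i₀ (allFin m) ,
  λ j → All.lookup (Extrema.f[argmin]≤f[xs] i₀ (allFin m)) (∈-allFin j)

min≤average : ∀ N (g : Fin N → ℚ) → Fin N → ∃ λ i → fromℕ N * g i ≤ sumFin N g
min≤average N g i₀ with argmin-Fin g i₀
... | i , gᵢ≤g = i , subst (_≤ sumFin N g) (sumFin-const N (g i)) (sumFin-mono N gᵢ≤g)

map? : ∀ n m → Dec (Fin n → Fin m)
map? zero    m       = yes (λ ())
map? (suc n) zero    = no (λ f → case f Fin.zero of λ ())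
map? (suc n) (suc m) = yes (λ _ → Fin.zero)

_◂_ : ∀ {n} {A : Set} → A → (Fin n → A) → Fin (suc n) → A
(a ◂ t) Fin.zero    = a
(a ◂ t) (Fin.suc i) = t i

argmin-maps : ∀ n {m} (f : (Fin n → Fin m) → ℚ) →
  (∀ {σ τ} → (∀ i → σ i ≡ τ i) → f σ ≡ f τ) →
  (Fin n → Fin m) → ∃ λ σ → ∀ τ → f σ ≤ f τ
argmin-maps zero    f resp σ₀ = σ₀ , λ τ → ℚP.≤-reflexive (resp (λ ()))
argmin-maps (suc n) {m} f resp σ₀ = (a* ◂ best a*) , λ τ → begin
    f (a* ◂ best a*)                          ≤⟨ a*-min (τ Fin.zero) ⟩
    f (τ Fin.zero ◂ best (τ Fin.zero))        ≤⟨ best-min (τ Fin.zero) (λ i → τ (Fin.suc i)) ⟩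
    f (τ Fin.zero ◂ (λ i → τ (Fin.suc i)))    ≡⟨ resp (λ { Fin.zero → refl ; (Fin.suc i) → refl }) ⟩
    f τ                                       ∎
  where
  open ℚP.≤-Reasoning
  minimiseRest : ∀ a → ∃ λ t → ∀ t' → f (a ◂ t) ≤ f (a ◂ t')
  minimiseRest a = argmin-maps n (λ t → f (a ◂ t))
    (λ t≗t' → resp (λ { Fin.zero → refl ; (Fin.suc i) → t≗t' i })) (λ i → σ₀ (Fin.suc i))
  best : Fin m → Fin n → Fin m
  best a = proj₁ (minimiseRest a)
  best-min : ∀ a t' → f (a ◂ best a) ≤ f (a ◂ t')
  best-min a = proj₂ (minimiseRest a)
  firstChoice : ∃ λ a → ∀ a' → f (a ◂ best a) ≤ f (a' ◂ best a')
  firstChoice = argmin-Fin (λ a → f (a ◂ best a)) (σ₀ Fin.zero)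
  a* : Fin m
  a* = proj₁ firstChoice
  a*-min : ∀ a' → f (a* ◂ best a*) ≤ f (a' ◂ best a')
  a*-min = proj₂ firstChoice

module Priority {n : ℕ} (key : Fin n → ℤ) where

  _⊑_ : Fin n → Fin n → Set
  k ⊑ j = key j ℤ.< key k ⊎ (key j ≡ key k × toℕ k ℕ.≤ toℕ j)

  ⊑-total : ∀ k j → k ⊑ j ⊎ j ⊑ k
  ⊑-total k j with ℤP.<-cmp (key j) (key k)
  ... | tri< j<k _ _ = inj₁ (inj₁ j<k)
  ... | tri> _ _ k<j = inj₂ (inj₁ k<j)
  ... | tri≈ _ j≡k _ with ℕP.≤-total (toℕ k) (toℕ j)
  ...   | inj₁ k≤j = inj₁ (inj₂ (j≡k , k≤j))
  ...   | inj₂ j≤k = inj₂ (inj₂ (sym j≡k , j≤k))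

  ⊑-antisym : ∀ {k j} → k ≢ j → k ⊑ j → j ⊑ k → ⊥
  ⊑-antisym _   (inj₁ j<k)       (inj₁ k<j)       = ℤP.<-asym j<k k<j
  ⊑-antisym _   (inj₁ j<k)       (inj₂ (k≡j , _)) = ℤP.<-irrefl (sym k≡j) j<k
  ⊑-antisym _   (inj₂ (j≡k , _)) (inj₁ k<j)       = ℤP.<-irrefl (sym j≡k) k<j
  ⊑-antisym k≢j (inj₂ (_ , k≤j)) (inj₂ (_ , j≤k)) =
    k≢j (FinP.toℕ-injective (ℕP.≤-antisym k≤j j≤k))

  -- the Boolean test used by the schedule (precedesOrEq of Defs)
  before : Fin n → Fin n → Bool
  before k j = ⌊ key j ℤ.<? key k ⌋ ∨ (⌊ key j ℤ.≟ key k ⌋ ∧ ⌊ toℕ k ℕ.≤? toℕ j ⌋)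

  before-sound : ∀ k j → before k j ≡ true → k ⊑ j
  before-sound k j b with key j ℤ.<? key k | key j ℤ.≟ key k | toℕ k ℕ.≤? toℕ j
  ... | yes j<k | _       | _       = inj₁ j<k
  ... | no _    | yes j≡k | yes k≤j = inj₂ (j≡k , k≤j)
  before-sound k j () | no _ | yes _ | no _
  before-sound k j () | no _ | no _  | _

  before-complete : ∀ k j → k ⊑ j → before k j ≡ true
  before-complete k j k⊑j with key j ℤ.<? key k | key j ℤ.≟ key k | toℕ k ℕ.≤? toℕ j
  ... | yes _ | _     | _     = refl
  ... | no _  | yes _ | yes _ = refl
  ... | no j≮k  | no j≢k | _       = ⊥-elim ([ j≮k , j≢k ∘ proj₁ ]′ k⊑j)
  ... | no j≮k  | yes _  | no k≰j  = ⊥-elim ([ j≮k , k≰j ∘ proj₂ ]′ k⊑j)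

  before-refl : ∀ j → before j j ≡ true
  before-refl j = before-complete j j (inj₂ (refl , ℕP.≤-refl))

  before-flip : ∀ k j → k ≢ j → before j k ≡ not (before k j)
  before-flip k j k≢j with before k j in k-first | before j k in j-first
  ... | true  | true  = ⊥-elim (⊑-antisym k≢j (before-sound k j k-first) (before-sound j k j-first))
  ... | true  | false = refl
  ... | false | true  = refl
  ... | false | false with ⊑-total k j
  ...   | inj₁ k⊑j = contradiction (trans (sym k-first) (before-complete k j k⊑j)) λ ()
  ...   | inj₂ j⊑k = contradiction (trans (sym j-first) (before-complete j k j⊑k)) λ ()

-- Smith's rule

cheaper-choice : ∀ x y {u v : ℚ} → (x ≡ true → u ≤ v) → (x ≡ false → v ≤ u) →
  (if x then u else v) ≤ (if y then u else v)
cheaper-choice true  true  _   _   = ℚP.≤-refl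
cheaper-choice true  false u≤v _   = u≤v refl
cheaper-choice false true  _   v≤u = v≤u refl
cheaper-choice false false _   _   = ℚP.≤-refl

halve-≤ : ∀ {x y} → x + x ≤ y + y → x ≤ y
halve-≤ {x} {y} x+x≤y+y with x ℚP.≤? y
... | yes x≤y = x≤y
... | no  x≰y = ⊥-elim (ℚP.<-irrefl refl (ℚP.≤-<-trans x+x≤y+y (ℚP.+-mono-< y<x y<x)))
  where
  y<x : y < x
  y<x = ℚP.≰⇒> x≰y

if-nonNeg : ∀ b {x} → 0ℚ ≤ x → 0ℚ ≤ (if b then x else 0ℚ)
if-nonNeg true  0≤x = 0≤x
if-nonNeg false _   = ℚP.≤-refl

-- One assignment σ of jobs to machines; p a j is the processing time of
-- job a on the machine of job j.  Each machine runs its jobs back to back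
-- in the order of a priority key.
module Sequencing {n m : ℕ} (σ : Fin n → Fin m) (p : Fin n → Fin n → ℚ) where
  open Priority using (_⊑_; before; before-refl; before-flip; before-sound)

  -- the time job a spends before the completion of job j (a = j included)
  delay : (Fin n → ℤ) → Fin n → Fin n → ℚ
  delay key a j = if ⌊ σ a Fin.≟ σ j ⌋ ∧ before key a j then p a j else 0ℚ

  completionTime : (Fin n → ℤ) → Fin n → ℚ
  completionTime key j = sumFin n (λ a → delay key a j)

  cost : (Fin n → ℚ) → (Fin n → ℤ) → ℚ
  cost w key = sumFin n (λ j → w j * completionTime key j)

  module _ (p-nonNeg : ∀ a j → 0ℚ ≤ p a j) where
    completionTime-nonNeg : ∀ key j → 0ℚ ≤ completionTime key j
    completionTime-nonNeg key j = sumFin-nonNeg n (λ a → if-nonNeg (⌊ σ a Fin.≟ σ j ⌋ ∧ before key a j) (p-nonNeg a j))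

    cost-nonNeg : ∀ {w} → (∀ j → 0ℚ ≤ w j) → ∀ key → 0ℚ ≤ cost w key
    cost-nonNeg w-nonNeg key = sumFin-nonNeg n (λ j → *-nonNeg (w-nonNeg j) (completionTime-nonNeg key j))

    cost-monoʷ : ∀ {w w'} → (∀ j → w j ≤ w' j) → ∀ key → cost w key ≤ cost w' key
    cost-monoʷ w≤w' key = sumFin-mono n (λ j → *-monoʳ-≤ (completionTime-nonNeg key j) (w≤w' j))

  term : (Fin n → ℚ) → (Fin n → ℤ) → Fin n → Fin n → ℚ
  term w key a j = w j * delay key a j

  delay-elsewhere : ∀ key key' a j → σ a ≢ σ j → delay key a j ≡ delay key' a j
  delay-elsewhere key key' a j σa≢σj with σ a Fin.≟ σ j
  ... | yes σa≡σj = ⊥-elim (σa≢σj σa≡σj)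
  ... | no _      = refl

  delay-self : ∀ key j → delay key j j ≡ p j j
  delay-self key j rewrite before-refl key j with σ j Fin.≟ σ j
  ... | yes _    = refl
  ... | no σj≢σj = ⊥-elim (σj≢σj refl)

  pair≡ : ∀ w key a j → σ a ≡ σ j → a ≢ j →
    term w key a j + term w key j a ≡ (if before key a j then w j * p a j else w a * p j a)
  pair≡ w key a j σa≡σj a≢j with σ a Fin.≟ σ j | σ j Fin.≟ σ a
  ... | no σa≢σj | _        = ⊥-elim (σa≢σj σa≡σj)
  ... | yes _    | no σj≢σa = ⊥-elim (σj≢σa (sym σa≡σj))
  ... | yes _    | yes _ rewrite before-flip key a j a≢j with before key a j
  ...   | true  = trans (cong (λ z → w j * p a j + z) (ℚP.*-zeroʳ (w a))) (ℚP.+-identityʳ _)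
  ...   | false = trans (cong (λ z → z + w a * p j a) (ℚP.*-zeroʳ (w j))) (ℚP.+-identityˡ _)

  cost-doubled : ∀ w key →
    cost w key + cost w key ≡ sumFin n (λ j → sumFin n (λ a → term w key a j + term w key j a))
  cost-doubled w key = begin
    cost w key + cost w key                   ≡⟨ cong₂ _+_ as-double as-double ⟩
    S + S                                     ≡⟨ cong (λ z → S + z) (sumFin-comm n n (λ j a → term w key a j)) ⟩
    S + sumFin n (λ j → sumFin n (λ a → term w key j a))
      ≡⟨ sumFin-+ n (λ j → sumFin n (λ a → term w key a j)) (λ j → sumFin n (λ a → term w key j a)) ⟨
    sumFin n (λ j → sumFin n (λ a → term w key a j) + sumFin n (λ a → term w key j a))
      ≡⟨ sumFin-cong n (λ j → sumFin-+ n (λ a → term w key a j) (λ a → term w key j a)) ⟨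
    sumFin n (λ j → sumFin n (λ a → term w key a j + term w key j a)) ∎
    where
    open ≡-Reasoning
    S : ℚ
    S = sumFin n (λ j → sumFin n (λ a → term w key a j))
    as-double : cost w key ≡ S
    as-double = sumFin-cong n (λ j → sumFin-*ˡ n (w j) (λ a → delay key a j))

  module _ (w : Fin n → ℚ) (κ : Fin n → ℤ)
           (exchange : ∀ a j → σ a ≡ σ j → κ j ℤ.≤ κ a → w j * p a j ≤ w a * p j a) where

    private
      key-≤ : ∀ {a j} → _⊑_ κ a j → κ j ℤ.≤ κ a
      key-≤ = [ ℤP.<⇒≤ , ℤP.≤-reflexive ∘ proj₁ ]′

    pair-cheaper : ∀ a j → σ a ≡ σ j → a ≢ j → ∀ key →
      (if before κ a j then w j * p a j else w a * p j a) ≤ (if before key a j then w j * p a j else w a * p j a)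
    pair-cheaper a j σa≡σj a≢j key = cheaper-choice (before κ a j) (before key a j) a-first j-first
      where
      a-first : before κ a j ≡ true → w j * p a j ≤ w a * p j a
      a-first b = exchange a j σa≡σj (key-≤ (before-sound κ a j b))
      j-first : before κ a j ≡ false → w a * p j a ≤ w j * p a j
      j-first b = exchange j a (sym σa≡σj)
        (key-≤ (before-sound κ j a (trans (before-flip κ a j a≢j) (cong not b))))

    pair-≤ : ∀ key a j → term w κ a j + term w κ j a ≤ term w key a j + term w key j a
    pair-≤ key a j = case σ a Fin.≟ σ j of λ where
      (no σa≢σj) → ℚP.≤-reflexive (cong₂ _+_
        (cong (w j *_) (delay-elsewhere κ key a j σa≢σj))
        (cong (w a *_) (delay-elsewhere κ key j a (σa≢σj ∘ sym))))
      (yes σa≡σj) → case a Fin.≟ j of λ where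
        (yes refl) → ℚP.≤-reflexive (cong (λ t → w a * t + w a * t)
                                       (trans (delay-self κ a) (sym (delay-self key a))))
        (no a≢j) → subst₂ _≤_ (sym (pair≡ w κ a j σa≡σj a≢j)) (sym (pair≡ w key a j σa≡σj a≢j))
                     (pair-cheaper a j σa≡σj a≢j key)

    smith : ∀ key → cost w κ ≤ cost w key
    smith key = halve-≤ (begin
      cost w κ + cost w κ                                               ≡⟨ cost-doubled w κ ⟩
      sumFin n (λ j → sumFin n (λ a → term w κ a j + term w κ j a))     ≤⟨ sumFin-mono n (λ j → sumFin-mono n (λ a → pair-≤ key a j)) ⟩
      sumFin n (λ j → sumFin n (λ a → term w key a j + term w key j a)) ≡⟨ cost-doubled w key ⟨
      cost w key + cost w key                                           ∎)
      where open ℚP.≤-Reasoning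

-- The blocks Ω_c and the boosted jobs

remainder-<-step : ∀ d {r r' : ℕ} {q q' : ℤ} → r ℕ.< d → q ℤ.< q' →
  + r ℤ.+ q ℤ.* + d ℤ.< + r' ℤ.+ q' ℤ.* + d
remainder-<-step d {r} {r'} {q} {q'} r<d q<q' = begin-strict
  + r ℤ.+ q ℤ.* + d       <⟨ ℤP.+-monoˡ-< (q ℤ.* + d) (ℤ.+<+ r<d) ⟩
  + d ℤ.+ q ℤ.* + d       ≡⟨ ℤP.suc-* q (+ d) ⟨
  ℤ.suc q ℤ.* + d         ≤⟨ ℤP.*-monoʳ-≤-nonNeg (+ d) (ℤP.i<j⇒suc[i]≤j q<q') ⟩
  q' ℤ.* + d              ≤⟨ ℤP.i≤j+i (q' ℤ.* + d) (+ r') ⟩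
  + r' ℤ.+ q' ℤ.* + d     ∎
  where open ℤP.≤-Reasoning

division-unique : ∀ d {r r' : ℕ} {q q' : ℤ} → r ℕ.< d → r' ℕ.< d →
  + r ℤ.+ q ℤ.* + d ≡ + r' ℤ.+ q' ℤ.* + d → r ≡ r' × q ≡ q'
division-unique d {r} {r'} {q} {q'} r<d r'<d eq with ℤP.<-cmp q q'
... | tri< q<q' _ _ = ⊥-elim (ℤP.<-irrefl eq (remainder-<-step d r<d q<q'))
... | tri> _ _ q'<q = ⊥-elim (ℤP.<-irrefl (sym eq) (remainder-<-step d r'<d q'<q))
... | tri≈ _ refl _ = ℤP.+-injective (begin
  + r                                 ≡⟨ add-sub (+ r) (q ℤ.* + d) ⟨
  + r ℤ.+ q ℤ.* + d ℤ.- q ℤ.* + d     ≡⟨ cong (ℤ._- q ℤ.* + d) eq ⟩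
  + r' ℤ.+ q ℤ.* + d ℤ.- q ℤ.* + d    ≡⟨ add-sub (+ r') (q ℤ.* + d) ⟩
  + r'                                ∎) , refl
  where
  open ≡-Reasoning
  add-sub : ∀ a x → a ℤ.+ x ℤ.- x ≡ a
  add-sub = solve-∀

module Blocks (ξ : ℕ) .{{_ : ℕ.NonZero ξ}} where

  division⇒∈Ω : ∀ {e c r} → r ℕ.< ξ → e ℤ.- ℤ.1ℤ ≡ + r ℤ.+ c ℤ.* + ξ → e ∈Ω[ ξ , c ]
  division⇒∈Ω {e} {c} {r} r<ξ e-1≡ = lower , upper
    where
    open ℤP.≤-Reasoning
    e≡ : e ≡ (ℤ.1ℤ ℤ.+ + r) ℤ.+ c ℤ.* + ξ
    e≡ = trans (sub-add e) (trans (cong (ℤ._+ ℤ.1ℤ) e-1≡) (shift (+ r) (c ℤ.* + ξ)))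
      where
      sub-add : ∀ e → e ≡ e ℤ.- ℤ.1ℤ ℤ.+ ℤ.1ℤ
      sub-add = solve-∀
      shift : ∀ a x → a ℤ.+ x ℤ.+ ℤ.1ℤ ≡ (ℤ.1ℤ ℤ.+ a) ℤ.+ x
      shift = solve-∀
    lower : c ℤ.* + ξ ℤ.+ + 1 ℤ.≤ e
    lower = begin
      c ℤ.* + ξ ℤ.+ + 1        ≡⟨ ℤP.+-comm (c ℤ.* + ξ) (+ 1) ⟩
      + 1 ℤ.+ c ℤ.* + ξ        ≤⟨ ℤP.+-monoˡ-≤ (c ℤ.* + ξ) (ℤ.+≤+ (ℕ.s≤s ℕ.z≤n)) ⟩
      + suc r ℤ.+ c ℤ.* + ξ    ≡⟨ e≡ ⟨
      e                        ∎
    upper : e ℤ.≤ (c ℤ.+ + 1) ℤ.* + ξ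
    upper = begin
      e                        ≡⟨ e≡ ⟩
      + suc r ℤ.+ c ℤ.* + ξ    ≤⟨ ℤP.+-monoˡ-≤ (c ℤ.* + ξ) (ℤ.+≤+ r<ξ) ⟩
      + ξ ℤ.+ c ℤ.* + ξ        ≡⟨ regroup c (+ ξ) ⟩
      (c ℤ.+ + 1) ℤ.* + ξ      ∎
      where
      regroup : ∀ c x → x ℤ.+ c ℤ.* x ≡ (c ℤ.+ ℤ.1ℤ) ℤ.* x
      regroup = solve-∀

  ∈Ω⇒division : ∀ {e c} → e ∈Ω[ ξ , c ] → ∃ λ r → r ℕ.< ξ × e ℤ.- ℤ.1ℤ ≡ + r ℤ.+ c ℤ.* + ξ
  ∈Ω⇒division {e} {c} (lower , upper) =
    ℤ.∣ t ∣ , ℤP.drop‿+<+ (subst (ℤ._< + ξ) (sym +∣t∣≡t) t<ξ) , trans e-1≡ (cong (ℤ._+ c ℤ.* + ξ) (sym +∣t∣≡t))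
    where
    open ℤP.≤-Reasoning
    t : ℤ
    t = e ℤ.- (c ℤ.* + ξ ℤ.+ + 1)
    +∣t∣≡t : + ℤ.∣ t ∣ ≡ t
    +∣t∣≡t = ℤP.0≤i⇒+∣i∣≡i (ℤP.i≤j⇒0≤j-i lower)
    t<ξ : t ℤ.< + ξ
    t<ξ = ℤP.suc[i]≤j⇒i<j (begin
      ℤ.suc t                              ≡⟨ suc-t e (c ℤ.* + ξ) ⟩
      e ℤ.- c ℤ.* + ξ                      ≤⟨ ℤP.+-monoˡ-≤ (ℤ.- (c ℤ.* + ξ)) upper ⟩
      (c ℤ.+ + 1) ℤ.* + ξ ℤ.- c ℤ.* + ξ    ≡⟨ one-block c (+ ξ) ⟩
      + ξ                                  ∎)
      where
      suc-t : ∀ e x → ℤ.1ℤ ℤ.+ (e ℤ.- (x ℤ.+ ℤ.1ℤ)) ≡ e ℤ.- x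
      suc-t = solve-∀
      one-block : ∀ c x → (c ℤ.+ ℤ.1ℤ) ℤ.* x ℤ.- c ℤ.* x ≡ x
      one-block = solve-∀
    e-1≡ : e ℤ.- ℤ.1ℤ ≡ t ℤ.+ c ℤ.* + ξ
    e-1≡ = split e (c ℤ.* + ξ)
      where
      split : ∀ e x → e ℤ.- ℤ.1ℤ ≡ (e ℤ.- (x ℤ.+ ℤ.1ℤ)) ℤ.+ x
      split = solve-∀

  block : ℤ → ℤ
  block e = (e ℤ.- ℤ.1ℤ) /ℕ ξ

  ∈Ω-block : ∀ e → e ∈Ω[ ξ , block e ]
  ∈Ω-block e = division⇒∈Ω {c = block e} (n%ℕd<d (e ℤ.- ℤ.1ℤ) ξ) (a≡a%ℕn+[a/ℕn]*n (e ℤ.- ℤ.1ℤ) ξ)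

  ∈Ω⇒block : ∀ {e c} → e ∈Ω[ ξ , c ] → c ≡ block e
  ∈Ω⇒block {e} {c} e∈Ωc with ∈Ω⇒division {e} {c} e∈Ωc
  ... | r , r<ξ , e-1≡ = proj₂ (division-unique ξ r<ξ (n%ℕd<d (e ℤ.- ℤ.1ℤ) ξ)
                                  (trans (sym e-1≡) (a≡a%ℕn+[a/ℕn]*n (e ℤ.- ℤ.1ℤ) ξ)))

  module Classes (N : ℕ) .{{_ : ℕ.NonZero N}} where
    InClass : ℕ → ℤ → Set
    InClass ζ e = ∃ λ (v : ℤ) → e ∈Ω[ ξ , v ℤ.* + N ℤ.+ + ζ ]

    slot : ℤ → ℕ
    slot e = block e %ℕ N

    slot<N : ∀ e → slot e ℕ.< N
    slot<N e = n%ℕd<d (block e) N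

    inClass-slot : ∀ e → InClass (slot e) e
    inClass-slot e = block e /ℕ N ,
      subst (e ∈Ω[ ξ ,_]) (trans (a≡a%ℕn+[a/ℕn]*n (block e) N) (ℤP.+-comm (+ slot e) ((block e /ℕ N) ℤ.* + N))) (∈Ω-block e)

    inClass⇒slot : ∀ {ζ e} → ζ ℕ.< N → InClass ζ e → ζ ≡ slot e
    inClass⇒slot {ζ} {e} ζ<N (v , e∈Ω) = proj₁ (division-unique N {q = v} {q' = block e /ℕ N} ζ<N (slot<N e)
      (trans (ℤP.+-comm (+ ζ) (v ℤ.* + N)) (trans (∈Ω⇒block {e} {v ℤ.* + N ℤ.+ + ζ} e∈Ω) (a≡a%ℕn+[a/ℕn]*n (block e) N))))

module Schedules (d : ℕ) {n m : ℕ} where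
  open Powers d

  processing : Instance n m → Solution n m → Fin n → Fin n → ℚ
  processing X σ a j = pw D (size X a ℤ.- speed X (σ j))

  processing-nonNeg : ∀ X σ a j → 0ℚ ≤ processing X σ a j
  processing-nonNeg X σ a j = pw-nonNeg (size X a ℤ.- speed X (σ j))

  module Seq (X : Instance n m) (σ : Solution n m) = Sequencing σ (processing X σ)

  -- by definition, SOL D σ X is Seq.cost X σ (weights X) (logDensity X)
  weights : Instance n m → Fin n → ℚ
  weights X j = pw D (weight X j)

  SOL-nonNeg : ∀ X σ → 0ℚ ≤ SOL D σ X
  SOL-nonNeg X σ = Seq.cost-nonNeg X σ (processing-nonNeg X σ) (λ j → pw-nonNeg (weight X j)) (logDensity X)

  SOL-resp : ∀ X {σ τ} → (∀ i → σ i ≡ τ i) → SOL D σ X ≡ SOL D τ X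
  SOL-resp X {σ} {τ} σ≗τ = sumFin-cong n (λ j → cong (weights X j *_) (sumFin-cong n (λ a → same-delay a j)))
    where
    same-delay : ∀ a j → Seq.delay X σ (logDensity X) a j ≡ Seq.delay X τ (logDensity X) a j
    same-delay a j rewrite σ≗τ a | σ≗τ j = refl

  SOL≤cost : ∀ X σ key → SOL D σ X ≤ Seq.cost X σ (weights X) key
  SOL≤cost X σ = Seq.smith X σ (weights X) (logDensity X)
    (λ a j σa≡σj ρj≤ρa → subst (λ i → weights X j * processing X σ a j ≤ weights X a * pw D (size X j ℤ.- speed X i))
                                (sym σa≡σj) (pw-exchange {weight X a} {size X a} {weight X j} {size X j} (speed X (σ j)) ρj≤ρa))

  SOL-monoʷ : ∀ X σ W → (∀ j → weight X j ℤ.≤ W j) → SOL D σ X ≤ SOL D σ (reweight X W)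
  SOL-monoʷ X σ W w≤W = ℚP.≤-trans (SOL≤cost X σ (logDensity (reweight X W)))
    (Seq.cost-monoʷ X σ (processing-nonNeg X σ) (λ j → pw-mono (w≤W j)) (logDensity (reweight X W)))

  optimal-exists : ∀ X → Solution n m → ∃ λ O → IsOptimal D X O
  optimal-exists X σ₀ = argmin-maps n (λ σ → SOL D σ X) (SOL-resp X) σ₀

-- D = k + 2 and ξ = ξ' + 1; ξ-bound is the bound (1+δ)^ξ ≤ 2 D^ℓ implied by the choice of ξ
module Rounding (k ℓ ξ' : ℕ) {n m : ℕ} (A' : Instance n m)
  (ξ-bound : pw (2 ℕ.+ k) (+ suc ξ') ≤ (+ 2 / 1) * fromℕ ((2 ℕ.+ k) ℕ.^ ℓ)) where

  open Powers (suc k)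
  open Schedules (suc k) {n} {m}

  ξ : ℕ
  ξ = suc ξ'

  N : ℕ
  N = D ℕ.^ suc ℓ

  instance
    N≢0 : ℕ.NonZero N
    N≢0 = ℕP.m^n≢0 D (suc ℓ)

  open Blocks ξ
  open Classes N

  ρ : ℚ
  ρ = 1ℚ + (+ 2 / 1) * δ D

  class : Fin n → ℕ
  class j = slot (logDensity A' j)

  -- A_ζ multiplies the weight of each job of class ζ by (1+δ)^ξ = 1 + boost
  boost : ℚ
  boost = pw D (+ ξ) - 1ℚ

  factor : ℕ → Fin n → ℚ
  factor ζ j = 1ℚ + (if ⌊ ζ ℕ.≟ class j ⌋ then boost else 0ℚ)

  module Weightsζ {ζ : ℕ} (ζ<N : ζ ℕ.< N) {w : Fin n → ℤ} (w-is : IsWeightsζ D ℓ ξ ζ A' w) where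
    private
      boosted : ∀ {j} → ζ ≡ class j → w j ≡ weight A' j ℤ.+ + ξ
      boosted {j} ζ≡class = proj₁ (w-is j)
        (subst (λ z → InClass z (logDensity A' j)) (sym ζ≡class) (inClass-slot (logDensity A' j)))
      unchanged : ∀ {j} → ζ ≢ class j → w j ≡ weight A' j
      unchanged {j} ζ≢class = proj₂ (w-is j) (ζ≢class ∘ inClass⇒slot ζ<N)

    weights-raised : ∀ j → weight A' j ℤ.≤ w j
    weights-raised j with ζ ℕ.≟ class j
    ... | yes ζ≡class = subst (weight A' j ℤ.≤_) (sym (boosted ζ≡class)) (ℤP.i≤i+j (weight A' j) (+ ξ))
    ... | no  ζ≢class = ℤP.≤-reflexive (sym (unchanged ζ≢class))

    weights-scaled : ∀ j → pw D (w j) ≡ pw D (weight A' j) * factor ζ j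
    weights-scaled j with ζ ℕ.≟ class j
    ... | yes ζ≡class = begin
      pw D (w j)                                ≡⟨ cong (pw D) (boosted ζ≡class) ⟩
      pw D (weight A' j ℤ.+ + ξ)                ≡⟨ pw-+ (weight A' j) (+ ξ) ⟩
      pw D (weight A' j) * pw D (+ ξ)           ≡⟨ cong (pw D (weight A' j) *_) (1+[x-1] (pw D (+ ξ))) ⟩
      pw D (weight A' j) * (1ℚ + boost)         ∎
      where
      open ≡-Reasoning
      open Data.Rational.Solver.+-*-Solver
      1+[x-1] : ∀ x → x ≡ 1ℚ + (x - 1ℚ)
      1+[x-1] = solve 1 (λ x → x := con 1ℚ :+ (x :- con 1ℚ)) refl
    ... | no ζ≢class = begin
      pw D (w j)                                ≡⟨ cong (pw D) (unchanged ζ≢class) ⟩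
      pw D (weight A' j)                        ≡⟨ ℚP.*-identityʳ (pw D (weight A' j)) ⟨
      pw D (weight A' j) * 1ℚ                   ≡⟨ cong (pw D (weight A' j) *_) (ℚP.+-identityʳ 1ℚ) ⟨
      pw D (weight A' j) * (1ℚ + 0ℚ)            ∎
      where open ≡-Reasoning

  part-i-lower : ∀ σ ζ → ζ ℕ.< N → ∀ w → IsWeightsζ D ℓ ξ ζ A' w → SOL D σ A' ≤ SOL D σ (reweight A' w)
  part-i-lower σ ζ ζ<N w w-is = SOL-monoʷ A' σ w (Weightsζ.weights-raised ζ<N w-is)

  C₀ : Solution n m → Fin n → ℚ
  C₀ σ = Seq.completionTime A' σ (logDensity A')

  F : Solution n m → ℕ → ℚ
  F σ ζ = sumFin n (λ j → (pw D (weight A' j) * factor ζ j) * C₀ σ j)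

  -- by Smith's rule, the sequencing of A' can only be worse for A_ζ
  SOL-Aζ≤F : ∀ σ {ζ} → ζ ℕ.< N → ∀ {w} → IsWeightsζ D ℓ ξ ζ A' w → SOL D σ (reweight A' w) ≤ F σ ζ
  SOL-Aζ≤F σ ζ<N {w} w-is = ℚP.≤-trans (SOL≤cost (reweight A' w) σ (logDensity A'))
    (ℚP.≤-reflexive (sumFin-cong n (λ j → cong (_* C₀ σ j) (Weightsζ.weights-scaled ζ<N w-is j))))

  -- every job is boosted in exactly one of the N instances A_ζ
  factor-sum : ∀ j → sumFin N (λ i → factor (toℕ i) j) ≡ fromℕ N + boost
  factor-sum j = trans (sumFin-+ N (λ _ → 1ℚ) (λ i → if ⌊ toℕ i ℕ.≟ class j ⌋ then boost else 0ℚ))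
    (cong₂ _+_ (trans (sumFin-const N 1ℚ) (ℚP.*-identityʳ (fromℕ N)))
               (sumFin-point N (class j) boost (slot<N (logDensity A' j))))

  sum-F : ∀ σ → sumFin N (λ i → F σ (toℕ i)) ≡ (fromℕ N + boost) * SOL D σ A'
  sum-F σ = begin
    sumFin N (λ i → sumFin n (λ j → (a j * factor (toℕ i) j) * C₀ σ j))
      ≡⟨ sumFin-comm N n (λ i j → (a j * factor (toℕ i) j) * C₀ σ j) ⟩
    sumFin n (λ j → sumFin N (λ i → (a j * factor (toℕ i) j) * C₀ σ j))
      ≡⟨ sumFin-cong n (λ j → sumFin-cong N (λ i → xy∙z≈xz∙y (a j) (factor (toℕ i) j) (C₀ σ j))) ⟩
    sumFin n (λ j → sumFin N (λ i → (a j * C₀ σ j) * factor (toℕ i) j))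
      ≡⟨ sumFin-cong n (λ j → sumFin-*ˡ N (a j * C₀ σ j) (λ i → factor (toℕ i) j)) ⟨
    sumFin n (λ j → (a j * C₀ σ j) * sumFin N (λ i → factor (toℕ i) j))
      ≡⟨ sumFin-cong n (λ j → trans (cong (a j * C₀ σ j *_) (factor-sum j)) (ℚP.*-comm (a j * C₀ σ j) (fromℕ N + boost))) ⟩
    sumFin n (λ j → (fromℕ N + boost) * (a j * C₀ σ j))
      ≡⟨ sumFin-*ˡ n (fromℕ N + boost) (λ j → a j * C₀ σ j) ⟨
    (fromℕ N + boost) * SOL D σ A'  ∎
    where
    open ≡-Reasoning
    a : Fin n → ℚ
    a j = pw D (weight A' j)

  -- N + boost ≤ N (1 + 2δ), because boost < (1+δ)^ξ ≤ 2 D^ℓ = 2 N δ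
  N+boost≤Nρ : fromℕ N + boost ≤ fromℕ N * ρ
  N+boost≤Nρ = begin
    fromℕ N + boost                          ≤⟨ ℚP.+-monoʳ-≤ (fromℕ N) (ℚP.≤-trans (x-1≤x (pw D (+ ξ))) ξ-bound) ⟩
    fromℕ N + (+ 2 / 1) * fromℕ (D ℕ.^ ℓ)    ≡⟨ cong (λ t → fromℕ N + (+ 2 / 1) * t) Nδ≡D^ℓ ⟨
    fromℕ N + (+ 2 / 1) * (fromℕ N * δ D)    ≡⟨ expand (fromℕ N) (δ D) ⟩
    fromℕ N * ρ                              ∎
    where
    open ℚP.≤-Reasoning
    Nδ≡D^ℓ : fromℕ N * δ D ≡ fromℕ (D ℕ.^ ℓ)
    Nδ≡D^ℓ = begin-equality
      fromℕ (D ℕ.* D ℕ.^ ℓ) * δ D              ≡⟨ cong (_* δ D) (fromℕ-* D (D ℕ.^ ℓ)) ⟩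
      (fromℕ D * fromℕ (D ℕ.^ ℓ)) * δ D        ≡⟨ xy∙z≈y∙xz (fromℕ D) (fromℕ (D ℕ.^ ℓ)) (δ D) ⟩
      fromℕ (D ℕ.^ ℓ) * (fromℕ D * δ D)        ≡⟨ cong (fromℕ (D ℕ.^ ℓ) *_) D*δ≡1 ⟩
      fromℕ (D ℕ.^ ℓ) * 1ℚ                     ≡⟨ ℚP.*-identityʳ _ ⟩
      fromℕ (D ℕ.^ ℓ)                          ∎
    open Data.Rational.Solver.+-*-Solver
    expand : ∀ x e → x + (+ 2 / 1) * (x * e) ≡ x * (1ℚ + (+ 2 / 1) * e)
    expand = solve 2 (λ x e → x :+ con (+ 2 / 1) :* (x :* e) := x :* (con 1ℚ :+ con (+ 2 / 1) :* e)) refl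

  below-average : ∀ σ ζ → fromℕ N * F σ ζ ≤ sumFin N (λ i → F σ (toℕ i)) → F σ ζ ≤ ρ * SOL D σ A'
  below-average σ ζ N*F≤ΣF = ℚP.*-cancelˡ-≤-pos (fromℕ N) {{ℚ.positive (fromℕ-pos N)}} (begin
    fromℕ N * F σ ζ                      ≤⟨ N*F≤ΣF ⟩
    sumFin N (λ i → F σ (toℕ i))         ≡⟨ sum-F σ ⟩
    (fromℕ N + boost) * SOL D σ A'       ≤⟨ *-monoʳ-≤ (SOL-nonNeg A' σ) N+boost≤Nρ ⟩
    (fromℕ N * ρ) * SOL D σ A'           ≡⟨ ℚP.*-assoc (fromℕ N) ρ (SOL D σ A') ⟩
    fromℕ N * (ρ * SOL D σ A')           ∎)
    where open ℚP.≤-Reasoning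

  part-i-upper : ∀ σ → ∃ λ ζ̄ → ζ̄ ℕ.< N ×
    (∀ w → IsWeightsζ D ℓ ξ ζ̄ A' w → SOL D σ (reweight A' w) ≤ ρ * SOL D σ A')
  part-i-upper σ = toℕ i , FinP.toℕ<n i ,
    λ w w-is → ℚP.≤-trans (SOL-Aζ≤F σ (FinP.toℕ<n i) w-is) (below-average σ (toℕ i) (proj₂ cheapest))
    where
    cheapest : ∃ λ i → fromℕ N * F σ (toℕ i) ≤ sumFin N (λ i → F σ (toℕ i))
    cheapest = min≤average N (λ i → F σ (toℕ i)) (Fin.fromℕ< (ℕP.m^n>0 D (suc ℓ)))
    i : Fin N
    i = proj₁ cheapest

  Guarantees : ℕ → Set
  Guarantees ζ' =
    (w : Fin n → ℤ) → IsWeightsζ D ℓ ξ ζ' A' w →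
    (O' : Solution n m) → IsOptimal D A' O' →
    (Oζ : Solution n m) → IsOptimal D (reweight A' w) Oζ →
      (SOL D O' A' ≤ SOL D Oζ (reweight A' w))
      × (SOL D Oζ (reweight A' w) ≤ ρ * SOL D O' A')
      × ((SOL₁ : Solution n m) → (k' : ℚ) → 0ℚ < k' →
          SOL D SOL₁ (reweight A' w) ≤ (1ℚ + k' * δ D) * SOL D Oζ (reweight A' w) →
          SOL D SOL₁ A' ≤ (1ℚ + ((+ 2 / 1) * k' + + 2 / 1) * δ D) * SOL D O' A')

  guarantees : ∀ O* → IsOptimal D A' O* → ∀ {ζ'} → ζ' ℕ.< N →
    (∀ w → IsWeightsζ D ℓ ξ ζ' A' w → SOL D O* (reweight A' w) ≤ ρ * SOL D O* A') → Guarantees ζ'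
  guarantees O* O*-optimal {ζ'} ζ'<N O*-bound w w-is O' O'-optimal Oζ Oζ-optimal = lower , upper , transfer
    where
    open ℚP.≤-Reasoning
    Aζ : Instance n m
    Aζ = reweight A' w
    lower : SOL D O' A' ≤ SOL D Oζ Aζ
    lower = ℚP.≤-trans (O'-optimal Oζ) (part-i-lower Oζ ζ' ζ'<N w w-is)
    upper : SOL D Oζ Aζ ≤ ρ * SOL D O' A'
    upper = begin
      SOL D Oζ Aζ         ≤⟨ Oζ-optimal O* ⟩
      SOL D O* Aζ         ≤⟨ O*-bound w w-is ⟩
      ρ * SOL D O* A'     ≤⟨ *-monoˡ-≤ (0≤1+x (*-nonNeg (fromℕ-nonNeg 2) δ-nonNeg)) (O*-optimal O') ⟩
      ρ * SOL D O' A'     ∎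
    transfer : (SOL₁ : Solution n m) → (k' : ℚ) → 0ℚ < k' →
      SOL D SOL₁ Aζ ≤ (1ℚ + k' * δ D) * SOL D Oζ Aζ →
      SOL D SOL₁ A' ≤ (1ℚ + ((+ 2 / 1) * k' + + 2 / 1) * δ D) * SOL D O' A'
    transfer SOL₁ k' 0<k' SOL₁-approx = begin
      SOL D SOL₁ A'                              ≤⟨ part-i-lower SOL₁ ζ' ζ'<N w w-is ⟩
      SOL D SOL₁ Aζ                              ≤⟨ SOL₁-approx ⟩
      (1ℚ + k' * δ D) * SOL D Oζ Aζ              ≤⟨ *-monoˡ-≤ (0≤1+x (*-nonNeg (ℚP.<⇒≤ 0<k') δ-nonNeg)) upper ⟩
      (1ℚ + k' * δ D) * (ρ * SOL D O' A')        ≡⟨ ℚP.*-assoc (1ℚ + k' * δ D) ρ (SOL D O' A') ⟨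
      ((1ℚ + k' * δ D) * ρ) * SOL D O' A'        ≤⟨ *-monoʳ-≤ (SOL-nonNeg A' O')
                                                      (approximation-chain (ℚP.<⇒≤ 0<k') δ-nonNeg (2δ≤1 k)) ⟩
      (1ℚ + ((+ 2 / 1) * k' + + 2 / 1) * δ D) * SOL D O' A' ∎

  -- an optimal solution of A' exists unless A' has no solution at all
  part-ii : ∃ λ ζ' → ζ' ℕ.< N × Guarantees ζ'
  part-ii = from (map? n m)
    where
    from : Dec (Solution n m) → ∃ λ ζ' → ζ' ℕ.< N × Guarantees ζ'
    from (no no-solution) = 0 , ℕP.m^n>0 D (suc ℓ) , λ _ _ O' → ⊥-elim (no-solution O')
    from (yes σ₀) =
      let O* , O*-optimal = optimal-exists A' σ₀
          ζ' , ζ'<N , O*-bound = part-i-upper O*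
      in  ζ' , ζ'<N , guarantees O* O*-optimal ζ'<N O*-bound

mainTheorem6 :
    (D : ℕ) .{{_ : ℕ.NonZero D}} → 8 ℕ.≤ D →
    (ℓ : ℕ) → 3 ℕ.≤ ℓ → ℓ ℕ.≤ 5 →
    (ξ : ℕ) → IsXi D ℓ ξ →
    ∀ {n m} (A' : Instance n m) →
    -- (i)
    ((σ : Solution n m) →
      ((ζ : ℕ) → ζ ℕ.< D ℕ.^ suc ℓ → (w : Fin n → ℤ) → IsWeightsζ D ℓ ξ ζ A' w →
        SOL D σ A' ℚ.≤ SOL D σ (reweight A' w))
      × (∃ λ (ζ̄ : ℕ) → ζ̄ ℕ.< D ℕ.^ suc ℓ ×
          ((w : Fin n → ℤ) → IsWeightsζ D ℓ ξ ζ̄ A' w →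
            SOL D σ (reweight A' w) ℚ.≤ (1ℚ ℚ.+ (+ 2 / 1) ℚ.* δ D) ℚ.* SOL D σ A')))
    ×
    -- (ii)
    (∃ λ (ζ' : ℕ) → ζ' ℕ.< D ℕ.^ suc ℓ ×
      ((w : Fin n → ℤ) → IsWeightsζ D ℓ ξ ζ' A' w →
       (O' : Solution n m) → IsOptimal D A' O' →
       (Oζ : Solution n m) → IsOptimal D (reweight A' w) Oζ →
         (SOL D O' A' ℚ.≤ SOL D Oζ (reweight A' w))
         × (SOL D Oζ (reweight A' w) ℚ.≤ (1ℚ ℚ.+ (+ 2 / 1) ℚ.* δ D) ℚ.* SOL D O' A')
         × ((SOL₁ : Solution n m) → (k' : ℚ) → 0ℚ ℚ.< k' →
             SOL D SOL₁ (reweight A' w) ℚ.≤ (1ℚ ℚ.+ k' ℚ.* δ D) ℚ.* SOL D Oζ (reweight A' w) →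
             SOL D SOL₁ A' ℚ.≤
               (1ℚ ℚ.+ ((+ 2 / 1) ℚ.* k' ℚ.+ + 2 / 1) ℚ.* δ D) ℚ.* SOL D O' A')))
mainTheorem6 (suc (suc k)) (ℕ.s≤s (ℕ.s≤s _)) ℓ@(suc ℓ') (ℕ.s≤s _) _ zero ξ-def _ =
  ⊥-elim (Powers.ξ≢0 (suc k) {ℓ} 2≤D^ℓ ξ-def)
  where
  2≤D^ℓ : 2 ℕ.≤ suc (suc k) ℕ.^ ℓ
  2≤D^ℓ = ℕP.≤-trans (ℕ.s≤s (ℕ.s≤s ℕ.z≤n))
                     (ℕP.m≤m*n (suc (suc k)) (suc (suc k) ℕ.^ ℓ') {{ℕP.m^n≢0 (suc (suc k)) ℓ'}})
mainTheorem6 (suc (suc k)) (ℕ.s≤s (ℕ.s≤s _)) ℓ _ _ (suc ξ') ξ-def A' =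
  (λ σ → part-i-lower σ , part-i-upper σ) , part-ii
  where open Rounding k ℓ ξ' A' (Powers.ξ-upper (suc k) {ℓ} ξ-def)
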